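{- Let $T$ be a DFS tree of an undirected graph $G=(V,E)$, and let $S$ be the shallow tree of $T$. Then any vertex $v\in V$ lying in a node $\mu$ of $S$ has edges in $G$ only to vertices lying in nodes of $S$ that are ancestors or descendants of $\mu$ in $S$ (including $\mu$ itself).
   Context: Heavy-light decomposition of a rooted tree $T$: each tree edge from a vertex to a child is marked solid if the subtree of that child is the heaviest (largest) among the subtrees of all children of that vertex, and dashed otherwise; the maximal sequences of vertices connected by solid edges form a set $\mathcal{P}$ of vertex-disjoint ancestor-descendant paths partitioning the vertices. The shallow tree $S$ of $T$ is the rooted tree obtained by collapsing each path of $\mathcal{P}$ into a single node; for each dashed edge $(y,z)$ with $y$ the parent of $z$ in $T$, the node of $S$ containing $y$ is the parent of the node containing $z$. A DFS tree is a rooted spanning tree produced by a depth first search, so every non-tree edge joins a vertex to an ancestor of it. -}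

module Defs where

open import Data.Nat using (ℕ; zero; suc; _≤_)
open import Data.Fin using (Fin; _≟_)
open import Data.Bool using (Bool; true; false)
open import Data.Bool.Properties using () renaming (_≟_ to _≟B_)
import Data.List.Base as L
open import Data.Product using (Σ; _×_; _,_)
open import Data.Sum using (_⊎_)
open import Relation.Nullary using (¬_; yes; no)
open import Relation.Binary.PropositionalEquality using (_≡_; _≢_)
open import Relation.Binary.Construct.Closure.ReflexiveTransitive using (Star)

-- Rooted trees on the vertex set Fin n, given by a root and a parent
-- function (the value of `par root` is irrelevant).

record RootedTree (n : ℕ) : Set where
  field
    root : Fin n
    par  : Fin n → Fin n

  Up : Fin n → Fin n → Set
  Up v u = (v ≢ root) × (par v ≡ u)

  Anc : Fin n → Fin n → Set
  Anc a d = Star Up d a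

  field
    reachesRoot : ∀ v → Anc root v

  -- Decidable ancestor test with fuel (depth of T is < n, so fuel n suffices)
  anc? : ℕ → Fin n → Fin n → Bool
  anc? fuel a d with d ≟ a
  ... | yes _ = true
  ... | no _ with d ≟ root
  ...   | yes _ = false
  ...   | no _ with fuel
  ...     | zero = false
  ...     | suc f = anc? f a (par d)

  size : Fin n → ℕ
  size c = L.length (L.filter (λ d → anc? n c d ≟B true) (L.tabulate (λ i → i)))

  TreeEdge : Fin n → Fin n → Set
  TreeEdge v w = Up v w ⊎ Up w v

record Graph (n : ℕ) : Set₁ where
  field
    E   : Fin n → Fin n → Set
    sym : ∀ {v w} → E v w → E w v

record IsDFSTree {n : ℕ} (G : Graph n) (T : RootedTree n) : Set where
  open Graph G
  open RootedTree T
  field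
    spanning : ∀ v w → Up v w → E v w
    nonTreeAncestral : ∀ v w → E v w → ¬ TreeEdge v w → Anc v w ⊎ Anc w v

-- Heavy-light decomposition.  `heavy p` is the child of p whose subtree is
-- heaviest (ties broken arbitrarily); it is only constrained when p has
-- at least one child.

record HeavyChoice {n : ℕ} (T : RootedTree n) : Set where
  open RootedTree T
  field
    heavy : Fin n → Fin n
    heavyIsChild : ∀ p c → Up c p → Up (heavy p) p
    heavyIsMax   : ∀ p c → Up c p → size c ≤ size (heavy p)

module HLD {n : ℕ} (T : RootedTree n) (H : HeavyChoice T) where
  open RootedTree T
  open HeavyChoice H

  Solid : Fin n → Set
  Solid v = Σ (Fin n) λ p → Up v p × (heavy p ≡ v)

  -- In v h : vertex v lies on the heavy path whose top vertex is h.
  -- Nodes of the shallow tree S are identified with the top vertices of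
  -- the paths in 𝒫.
  data In : Fin n → Fin n → Set where
    top  : ∀ {v} → ¬ Solid v → In v v
    step : ∀ {v p h} → Solid v → Up v p → In p h → In v h

  -- SParent μ ν : node ν is the parent of node μ in S
  -- (μ has top h; the dashed edge (par h, h) makes the node of par h the parent)
  SParent : Fin n → Fin n → Set
  SParent μ ν = In μ μ × Σ (Fin n) λ y → Up μ y × In y ν

  SAnc : Fin n → Fin n → Set
  SAnc α δ = Star SParent δ α

-- In a DFS tree every edge of G, tree edge or not, joins a vertex to one of
-- its ancestors.  Climbing one tree edge from v to its parent p either stays
-- on the heavy path of v (a solid edge) or leaves the top of that path along
-- a dashed edge, in which case the node of p is the parent in S of the node
-- of v.  So the ancestor relation of T is carried into that of S.
module Submission where

open import Defs
open import Data.Nat using (ℕ)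
open import Data.Fin using (Fin; _≟_)
open import Data.Sum using (_⊎_; inj₁; inj₂; [_,_])
open import Data.Product using (∃; _,_; proj₁; proj₂)
open import Data.Empty using (⊥-elim)
open import Relation.Nullary using (yes; no; Dec)
open import Relation.Binary.PropositionalEquality using (_≡_; refl; sym; trans)
open import Relation.Binary.Construct.Closure.ReflexiveTransitive using (ε; _◅_; _◅◅_)

module _ {n : ℕ} (T : RootedTree n) where
  open RootedTree T

  Up-functional : ∀ {v p q} → Up v p → Up v q → p ≡ q
  Up-functional (_ , par≡p) (_ , par≡q) = trans (sym par≡p) par≡q

  Up? : ∀ v p → Dec (Up v p)
  Up? v p with v ≟ root | par v ≟ p
  ... | yes v≡root | _         = no λ up → proj₁ up v≡root
  ... | no v≢root  | yes par≡p = yes (v≢root , par≡p)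
  ... | no _       | no par≢p  = no λ up → par≢p (proj₂ up)

module _ {n : ℕ} {G : Graph n} {T : RootedTree n} (D : IsDFSTree G T) where
  open Graph G
  open RootedTree T
  open IsDFSTree D

  edge⇒comparable : ∀ {v w} → E v w → Anc v w ⊎ Anc w v
  edge⇒comparable {v} {w} e with Up? T v w | Up? T w v
  ... | yes v↑w | _       = inj₂ (v↑w ◅ ε)
  ... | no _    | yes w↑v = inj₁ (w↑v ◅ ε)
  ... | no v↑̸w  | no w↑̸v  = nonTreeAncestral v w e [ v↑̸w , w↑̸v ]

module _ {n : ℕ} (T : RootedTree n) (H : HeavyChoice T) where
  open RootedTree T
  open HeavyChoice H
  open HLD T H

  In-functional : ∀ {v μ ν} → In v μ → In v ν → μ ≡ ν
  In-functional (top _)          (top _)          = refl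
  In-functional (top dashed)     (step solid _ _) = ⊥-elim (dashed solid)
  In-functional (step solid _ _) (top dashed)     = ⊥-elim (dashed solid)
  In-functional (step _ v↑p p∈μ) (step _ v↑q q∈ν) with Up-functional T v↑p v↑q
  ... | refl = In-functional p∈μ q∈ν

  Solid? : ∀ v → Dec (Solid v)
  Solid? v with v ≟ root | heavy (par v) ≟ v
  ... | yes v≡root | _        = no λ (_ , v↑p , _) → proj₁ v↑p v≡root
  ... | no v≢root  | yes heavy = yes (par v , (v≢root , refl) , heavy)
  ... | no _       | no light  = no λ { (_ , (_ , refl) , heavy) → light heavy }

  In-total : ∀ v → ∃ (In v)
  In-total v = onPathToRoot (reachesRoot v)
    where
    onPathToRoot : ∀ {u} → Anc root u → ∃ (In u)
    onPathToRoot {u} ε = u , top λ (_ , u↑p , _) → proj₁ u↑p refl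
    onPathToRoot {u} (u↑p ◅ p↝root) with Solid? u
    ... | yes solid = let μ , p∈μ = onPathToRoot p↝root in μ , step solid u↑p p∈μ
    ... | no dashed = u , top dashed

  Up⇒SAnc : ∀ {v p μ ν} → Up v p → In v μ → In p ν → SAnc ν μ
  Up⇒SAnc v↑p (top dashed) p∈ν = (top dashed , _ , v↑p , p∈ν) ◅ ε
  Up⇒SAnc v↑p (step _ v↑q q∈μ) p∈ν with Up-functional T v↑p v↑q
  ... | refl with In-functional q∈μ p∈ν
  ...   | refl = ε

  Anc⇒SAnc : ∀ {a d α δ} → Anc a d → In a α → In d δ → SAnc α δ
  Anc⇒SAnc ε a∈α d∈δ with In-functional a∈α d∈δ
  ... | refl = ε
  Anc⇒SAnc (_◅_ {j = p} d↑p p↝a) a∈α d∈δ =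
    let π , p∈π = In-total p in Up⇒SAnc d↑p d∈δ p∈π ◅◅ Anc⇒SAnc p↝a a∈α p∈π

lemma4 : {n : ℕ} (G : Graph n) (T : RootedTree n) → IsDFSTree G T →
         (H : HeavyChoice T) →
         ∀ (v w μ ν : Fin n) → Graph.E G v w →
         HLD.In T H v μ → HLD.In T H w ν →
         HLD.SAnc T H μ ν ⊎ HLD.SAnc T H ν μ
lemma4 G T D H v w μ ν e v∈μ w∈ν with edge⇒comparable D e
... | inj₁ v↝w = inj₁ (Anc⇒SAnc T H v↝w v∈μ w∈ν)
... | inj₂ w↝v = inj₂ (Anc⇒SAnc T H w↝v w∈ν v∈μ)
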